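{- Let $k \ge 1$, let $X$ be a $k$-cell, and let $t \ge 0$ be an integer with $2t < N L_{k-1}$. Suppose that $X$ is safe for $t$ steps. If $P$ and $Q$ are a separated pair of $(k-1)$-cells contained in $X$, then at least one of $P$ and $Q$ is safe for $t$ steps.
   Context: Fix positive integers $N$ and $C$. For $k \ge 0$ let $L_k = \prod_{j=0}^{k} (2j+1)^2$. Consider the square grid (squares of a board, two squares adjacent iff they share an edge), with distance meaning graph distance in this grid, and a finite set of cops, each located on some square (several cops may share a square). The grid is hierarchically tiled: a $0$-cell is an $N\times N$ block of squares, and for $k\ge 1$ a $k$-cell is an $NL_k \times NL_k$ block of squares which is partitioned into a $(2k+1)^2 \times (2k+1)^2$ array of $(k-1)$-cells (each an $NL_{k-1}\times NL_{k-1}$ block). A $k$-cell is said to be safe for $t$ steps if the set of cops at distance at most $t$ from the $k$-cell (i.e. from some square of it) has cardinality strictly less than $2^k$. Two cells are separated if they share neither an edge nor a corner. -}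

module Defs where

open import Data.Nat as ℕ using (ℕ; zero; suc)
open import Data.Integer as ℤ using (ℤ; +_)
open import Data.Fin using (Fin)
open import Data.Product using (_×_; _,_; Σ; ∃-syntax)
open import Data.Sum using (_⊎_)
open import Function.Definitions using (Injective)
open import Relation.Binary.PropositionalEquality using (_≡_)

L : ℕ → ℕ
L zero = 1
L (suc k) = L k ℕ.* ((2 ℕ.* suc k ℕ.+ 1) ℕ.* (2 ℕ.* suc k ℕ.+ 1))

Square : Set
Square = ℤ × ℤ

-- graph distance in the square grid (Manhattan distance)
dist : Square → Square → ℕ
dist (x , y) (x' , y') = ℤ.∣ x ℤ.- x' ∣ ℕ.+ ℤ.∣ y ℤ.- y' ∣

side : ℕ → ℕ → ℕ
side N k = N ℕ.* L k

-- a k-cell is identified by its index (a , b) in the hierarchical tiling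
-- anchored at the origin: it is the block of squares (x , y) with
-- a*s ≤ x < (a+1)*s and b*s ≤ y < (b+1)*s, s = N * L k.
Cell : Set
Cell = ℤ × ℤ

_∈Cell[_,_,_] : Square → ℕ → ℕ → Cell → Set
(x , y) ∈Cell[ N , k , (a , b) ] =
  (a ℤ.* + side N k ℤ.≤ x) × (x ℤ.< (a ℤ.+ + 1) ℤ.* + side N k) ×
  (b ℤ.* + side N k ℤ.≤ y) × (y ℤ.< (b ℤ.+ + 1) ℤ.* + side N k)

ContainedIn : ℕ → ℕ → Cell → Cell → Set
ContainedIn N j P X = ∀ s → s ∈Cell[ N , j , P ] → s ∈Cell[ N , suc j , X ]

-- two cells of the same level are separated: they share neither an edge
-- nor a corner, i.e. their indices differ by at least 2 in some coordinate
Separated : Cell → Cell → Set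
Separated (a , b) (a' , b') = (2 ℕ.≤ ℤ.∣ a ℤ.- a' ∣) ⊎ (2 ℕ.≤ ℤ.∣ b ℤ.- b' ∣)

-- a configuration of n cops: cop i sits on square (cops i); several cops
-- may share a square
Cops : ℕ → Set
Cops n = Fin n → Square

Near : ℕ → {n : ℕ} → Cops n → ℕ → ℕ → Cell → Fin n → Set
Near N cops t k c i = ∃[ s ] (s ∈Cell[ N , k , c ] × (dist (cops i) s ℕ.≤ t))

-- the k-cell c is safe for t steps: the set of cops at distance ≤ t from c
-- has cardinality < 2^k; i.e. every injective family of m cops all at
-- distance ≤ t from c has m < 2^k.
SafeFor : ℕ → {n : ℕ} → Cops n → ℕ → ℕ → Cell → Set
SafeFor N {n} cops t k c =
  ∀ (m : ℕ) (f : Fin m → Fin n) → Injective _≡_ _≡_ f →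
  (∀ i → Near N cops t k c (f i)) → m ℕ.< 2 ℕ.^ k

-- Because 2t < N·L_j, no cop can be within distance t of both
-- of two separated j-cells P and Q: squares of P and Q are more than N·L_j
-- apart in some coordinate, so a square within t of both would give a
-- detour of length ≤ 2t between them.  Hence the cops near P and the cops
-- near Q are disjoint sets, and all of them are near X because P, Q ⊆ X.
-- If both sets had at least 2^j members, X would have at least 2^(j+1)
-- cops near it, contradicting its safety.
--
-- Constructively we must decide which of P and Q is safe, so the set of
-- cops near a cell is made explicit as a duplicate-free list.
module Submission where

open import Defs
open import Data.Nat using (ℕ; suc; _*_; _<_; _≤_)
open import Data.Sum using (_⊎_)

open import Level using (Level)
open import Data.Nat as ℕ using (_+_)
import Data.Nat.Properties as ℕP
open import Data.Integer as ℤ using (ℤ; +_; ∣_∣)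
import Data.Integer.Properties as ℤP
open import Data.Integer.Tactic.RingSolver using (solve-∀)
open import Data.Fin as Fin using (Fin; toℕ; fromℕ<)
import Data.Fin.Properties as FinP
open import Data.List using (List; _∷_; length; lookup; filter; allFin)
open import Data.List.Properties using (length-++)
open import Data.List.Membership.Propositional using (_∈_)
open import Data.List.Membership.Propositional.Properties
  using (∈-lookup; ∈-filter⁺; ∈-filter⁻; ∈-allFin; ∈-++⁻)
open import Data.List.Membership.Setoid.Properties using (index-injective)
import Data.List.Relation.Unary.All as All
open import Data.List.Relation.Unary.Any using (index)
open import Data.List.Relation.Unary.AllPairs using (_∷_)
open import Data.List.Relation.Unary.Unique.Propositional using (Unique)
import Data.List.Relation.Unary.Unique.Propositional.Properties as Unique
open import Data.List.Relation.Binary.Disjoint.Propositional using (Disjoint)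
open import Data.Product using (_×_; _,_; ∃-syntax; proj₂)
open import Data.Sum as Sum using (inj₁; inj₂)
open import Data.Empty using (⊥; ⊥-elim)
open import Function.Definitions using (Injective)
open import Relation.Nullary using (Dec; yes; no; contradiction)
open import Relation.Nullary.Decidable using (map′)
open import Relation.Unary using (Decidable)
open import Relation.Binary.PropositionalEquality
  using (_≡_; refl; sym; cong; subst; subst₂; setoid; module ≡-Reasoning)

private
  variable
    ℓ : Level
    A : Set ℓ

-- SafeFor is this notion
-- for the predicate "near the cell" and the bound 2^k.
FewerThan : {A : Set ℓ} → (A → Set) → ℕ → Set ℓ
FewerThan {A = A} F b =
  ∀ (m : ℕ) (f : Fin m → A) → Injective _≡_ _≡_ f → (∀ i → F (f i)) → m < b

-- Pigeonhole: an injective family with all members in xs has at most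
-- length xs members (send each member to its position in xs).
injection-into-list : (xs : List A) {m : ℕ} (f : Fin m → A) →
  Injective _≡_ _≡_ f → (∀ i → f i ∈ xs) → m ≤ length xs
injection-into-list {A = A} xs f f-inj f∈xs =
  FinP.injective⇒≤ {f = λ i → index (f∈xs i)}
    (λ same-index → f-inj (index-injective (setoid A) (f∈xs _) (f∈xs _) same-index))

lookup-injective : {xs : List A} → Unique xs → Injective _≡_ _≡_ (lookup xs)
lookup-injective {xs = x ∷ xs} (x∉xs ∷ xs!) {Fin.zero} {Fin.zero} _ = refl
lookup-injective {xs = x ∷ xs} (x∉xs ∷ xs!) {Fin.zero} {Fin.suc j} x≡xⱼ =
  contradiction x≡xⱼ (All.lookup x∉xs (∈-lookup j))
lookup-injective {xs = x ∷ xs} (x∉xs ∷ xs!) {Fin.suc i} {Fin.zero} xᵢ≡x =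
  contradiction (sym xᵢ≡x) (All.lookup x∉xs (∈-lookup i))
lookup-injective {xs = x ∷ xs} (x∉xs ∷ xs!) {Fin.suc i} {Fin.suc j} xᵢ≡xⱼ =
  cong Fin.suc (lookup-injective xs! xᵢ≡xⱼ)

fewerThan-from-list : {F : A → Set} {b : ℕ} (xs : List A) →
  (∀ {v} → F v → v ∈ xs) → length xs < b → FewerThan F b
fewerThan-from-list xs F⊆xs short m f f-inj F-f =
  ℕP.≤-<-trans (injection-into-list xs f f-inj (λ i → F⊆xs (F-f i))) short

fewerThan-bounds-list : {F : A → Set} {b : ℕ} {xs : List A} →
  FewerThan F b → Unique xs → (∀ {v} → v ∈ xs → F v) → length xs < b
fewerThan-bounds-list {xs = xs} fewer xs! xs⊆F =
  fewer (length xs) (lookup xs) (lookup-injective xs!) (λ i → xs⊆F (∈-lookup i))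

one-of-disjoint-lists-short : {F : A → Set} {b : ℕ} {xs ys : List A} →
  FewerThan F (2 * b) → Unique xs → Unique ys → Disjoint xs ys →
  (∀ {v} → v ∈ xs → F v) → (∀ {v} → v ∈ ys → F v) →
  length xs < b ⊎ length ys < b
one-of-disjoint-lists-short {b = b} {xs} {ys} fewer xs! ys! xs#ys xs⊆F ys⊆F
  with length xs ℕ.<? b | length ys ℕ.<? b
... | yes xs-short | _ = inj₁ xs-short
... | no _ | yes ys-short = inj₂ ys-short
... | no xs-long | no ys-long =
  ⊥-elim (ℕP.<⇒≱ both-short both-long)
  where
  both-short : length xs + length ys < 2 * b
  both-short = subst (_< 2 * b) (length-++ xs)
    (fewerThan-bounds-list fewer (Unique.++⁺ xs! ys! xs#ys)
      (λ v∈xs++ys → Sum.[ xs⊆F , ys⊆F ] (∈-++⁻ xs v∈xs++ys)))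
  both-long : 2 * b ≤ length xs + length ys
  both-long = ℕP.+-mono-≤ (ℕP.≮⇒≥ xs-long)
    (subst (_≤ length ys) (sym (ℕP.+-identityʳ b)) (ℕP.≮⇒≥ ys-long))

satisfying : {n : ℕ} {D : Fin n → Set} → Decidable D → List (Fin n)
satisfying {n} D? = filter D? (allFin n)

satisfying-unique : {n : ℕ} {D : Fin n → Set} (D? : Decidable D) →
  Unique (satisfying D?)
satisfying-unique {n} D? = Unique.filter⁺ D? (Unique.allFin⁺ n)

∈-satisfying⁺ : {n : ℕ} {D : Fin n → Set} (D? : Decidable D) {i : Fin n} →
  D i → i ∈ satisfying D?
∈-satisfying⁺ D? {i} Di = ∈-filter⁺ D? (∈-allFin i) Di

∈-satisfying⁻ : {n : ℕ} {D : Fin n → Set} (D? : Decidable D) {i : Fin n} →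
  i ∈ satisfying D? → D i
∈-satisfying⁻ {n} D? i∈ = proj₂ (∈-filter⁻ D? {xs = allFin n} i∈)

record InBlock (a : ℤ) (d : ℕ) (x : ℤ) : Set where
  constructor block
  field
    lower : a ℤ.* + d ℤ.≤ x
    upper : x ℤ.< (a ℤ.+ + 1) ℤ.* + d

cell⇒blocks : {N k : ℕ} {a b x y : ℤ} → (x , y) ∈Cell[ N , k , (a , b) ] →
  InBlock a (side N k) x × InBlock b (side N k) y
cell⇒blocks (ad≤x , x<[a+1]d , bd≤y , y<[b+1]d) = block ad≤x x<[a+1]d , block bd≤y y<[b+1]d

blocks⇒cell : {N k : ℕ} {a b x y : ℤ} →
  InBlock a (side N k) x → InBlock b (side N k) y → (x , y) ∈Cell[ N , k , (a , b) ]
blocks⇒cell (block ad≤x x<[a+1]d) (block bd≤y y<[b+1]d) = ad≤x , x<[a+1]d , bd≤y , y<[b+1]d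

+<⇒<∣∣ : {d : ℕ} {z : ℤ} → + d ℤ.< z → d < ∣ z ∣
+<⇒<∣∣ (ℤ.+<+ d<n) = d<n

-- Points of blocks a' + 2 ≤ a are more than d apart: the whole block
-- a' + 1 lies between them.
blocks-far-ordered : {a a' x x' : ℤ} {d : ℕ} → a' ℤ.+ + 2 ℤ.≤ a →
  InBlock a d x → InBlock a' d x' → d < ∣ x ℤ.- x' ∣
blocks-far-ordered {a} {a'} {x} {x'} {d} a'+2≤a (block ad≤x _) (block _ x'<[a'+1]d) =
  +<⇒<∣∣ (begin-strict
    + d                              ≡⟨ sym (add-sub x' (+ d)) ⟩
    x' ℤ.+ + d ℤ.- x'                <⟨ ℤP.+-monoˡ-< (ℤ.- x') (begin-strict
      x' ℤ.+ + d                       <⟨ ℤP.+-monoˡ-< (+ d) x'<[a'+1]d ⟩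
      (a' ℤ.+ + 1) ℤ.* + d ℤ.+ + d     ≡⟨ next-block a' (+ d) ⟩
      (a' ℤ.+ + 2) ℤ.* + d             ≤⟨ ℤP.*-monoʳ-≤-nonNeg (+ d) a'+2≤a ⟩
      a ℤ.* + d                        ≤⟨ ad≤x ⟩
      x                                ∎) ⟩
    x ℤ.- x'                         ∎)
  where
  open ℤP.≤-Reasoning
  add-sub : ∀ y e → y ℤ.+ e ℤ.- y ≡ e
  add-sub = solve-∀
  next-block : ∀ i e → (i ℤ.+ + 1) ℤ.* e ℤ.+ e ≡ (i ℤ.+ + 2) ℤ.* e
  next-block = solve-∀

index-gap : {a a' : ℤ} → a' ℤ.≤ a → 2 ≤ ∣ a ℤ.- a' ∣ → a' ℤ.+ + 2 ℤ.≤ a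
index-gap {a} {a'} a'≤a 2≤∣a-a'∣ = begin
  a' ℤ.+ + 2              ≤⟨ ℤP.+-monoʳ-≤ a' (ℤ.+≤+ 2≤∣a-a'∣) ⟩
  a' ℤ.+ + ∣ a ℤ.- a' ∣   ≡⟨ cong (λ e → a' ℤ.+ + e) (ℤP.∣i-j∣≡∣j-i∣ a a') ⟩
  a' ℤ.+ + ∣ a' ℤ.- a ∣   ≡⟨ cong (λ e → a' ℤ.+ e) (ℤP.∣-∣-≤ a'≤a) ⟩
  a' ℤ.+ (a ℤ.- a')       ≡⟨ add-diff a a' ⟩
  a                       ∎
  where
  open ℤP.≤-Reasoning
  add-diff : ∀ i j → j ℤ.+ (i ℤ.- j) ≡ i
  add-diff = solve-∀

blocks-far : {a a' x x' : ℤ} {d : ℕ} → 2 ≤ ∣ a ℤ.- a' ∣ →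
  InBlock a d x → InBlock a' d x' → d < ∣ x ℤ.- x' ∣
blocks-far {a} {a'} {x} {x'} 2≤∣a-a'∣ x∈a x'∈a' with ℤP.≤-total a' a
... | inj₁ a'≤a = blocks-far-ordered (index-gap a'≤a 2≤∣a-a'∣) x∈a x'∈a'
... | inj₂ a≤a' = subst (_ <_) (ℤP.∣i-j∣≡∣j-i∣ x' x)
  (blocks-far-ordered (index-gap a≤a' (subst (2 ≤_) (ℤP.∣i-j∣≡∣j-i∣ a a') 2≤∣a-a'∣)) x'∈a' x∈a)

∣-∣-triangle : ∀ x c x' → ∣ x ℤ.- x' ∣ ≤ ∣ c ℤ.- x ∣ + ∣ c ℤ.- x' ∣
∣-∣-triangle x c x' = begin
  ∣ x ℤ.- x' ∣                      ≡⟨ cong ∣_∣ (sym (ℤP.+-minus-telescope x c x')) ⟩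
  ∣ (x ℤ.- c) ℤ.+ (c ℤ.- x') ∣      ≤⟨ ℤP.∣i+j∣≤∣i∣+∣j∣ (x ℤ.- c) (c ℤ.- x') ⟩
  ∣ x ℤ.- c ∣ + ∣ c ℤ.- x' ∣        ≡⟨ cong (_+ ∣ c ℤ.- x' ∣) (ℤP.∣i-j∣≡∣j-i∣ x c) ⟩
  ∣ c ℤ.- x ∣ + ∣ c ℤ.- x' ∣        ∎
  where open ℕP.≤-Reasoning

axis-not-near-both : {t d : ℕ} {a a' x x' : ℤ} (c : ℤ) → 2 * t < d →
  2 ≤ ∣ a ℤ.- a' ∣ → InBlock a d x → InBlock a' d x' →
  ∣ c ℤ.- x ∣ ≤ t → ∣ c ℤ.- x' ∣ ≤ t → ⊥
axis-not-near-both {t} {d} {x = x} {x'} c 2t<d 2≤∣a-a'∣ x∈a x'∈a' cx≤t cx'≤t =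
  ℕP.<-irrefl refl (begin-strict
    2 * t                           <⟨ 2t<d ⟩
    d                               <⟨ blocks-far 2≤∣a-a'∣ x∈a x'∈a' ⟩
    ∣ x ℤ.- x' ∣                    ≤⟨ ∣-∣-triangle x c x' ⟩
    ∣ c ℤ.- x ∣ + ∣ c ℤ.- x' ∣      ≤⟨ ℕP.+-mono-≤ cx≤t cx'≤t ⟩
    t + t                           ≡⟨ cong (λ e → t + e) (sym (ℕP.+-identityʳ t)) ⟩
    2 * t                           ∎)
  where open ℕP.≤-Reasoning

Within : ℕ → ℕ → ℕ → Cell → Square → Set
Within N t k c q = ∃[ s ] (s ∈Cell[ N , k , c ] × dist q s ≤ t)

-- When 2t is less than the side of a j-cell, no square is within distance
-- t of two separated j-cells: they are more than a side apart along the
-- axis in which their indices differ by at least 2.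
not-within-both : {N t j : ℕ} (P Q : Cell) → 2 * t < side N j → Separated P Q →
  (q : Square) → Within N t j P q → Within N t j Q q → ⊥
not-within-both {N} {t} {j} (a , b) (a' , b') 2t<d P#Q (qx , qy)
  ((x , y) , s∈P , qs≤t) ((x' , y') , s'∈Q , qs'≤t)
  with cell⇒blocks {N} {j} {a} {b} s∈P | cell⇒blocks {N} {j} {a'} {b'} s'∈Q | P#Q
... | x∈ , _ | x'∈ , _ | inj₁ 2≤∣a-a'∣ =
  axis-not-near-both qx 2t<d 2≤∣a-a'∣ x∈ x'∈
    (ℕP.≤-trans (ℕP.m≤m+n _ _) qs≤t) (ℕP.≤-trans (ℕP.m≤m+n _ _) qs'≤t)
... | _ , y∈ | _ , y'∈ | inj₂ 2≤∣b-b'∣ =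
  axis-not-near-both qy 2t<d 2≤∣b-b'∣ y∈ y'∈
    (ℕP.≤-trans (ℕP.m≤n+m _ _) qs≤t) (ℕP.≤-trans (ℕP.m≤n+m _ _) qs'≤t)

blockPoint : ℤ → (d : ℕ) → Fin d → ℤ
blockPoint a d u = a ℤ.* + d ℤ.+ + toℕ u

blockPoint-inBlock : (a : ℤ) (d : ℕ) (u : Fin d) → InBlock a d (blockPoint a d u)
blockPoint-inBlock a d u = block (ℤP.i≤i+j (a ℤ.* + d) (+ toℕ u)) (begin-strict
  a ℤ.* + d ℤ.+ + toℕ u   <⟨ ℤP.+-monoʳ-< (a ℤ.* + d) (ℤ.+<+ (FinP.toℕ<n u)) ⟩
  a ℤ.* + d ℤ.+ + d       ≡⟨ sym (next-block a (+ d)) ⟩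
  (a ℤ.+ + 1) ℤ.* + d     ∎)
  where
  open ℤP.≤-Reasoning
  next-block : ∀ i e → (i ℤ.+ + 1) ℤ.* e ≡ i ℤ.* e ℤ.+ e
  next-block = solve-∀

-- Every integer of the block is enumerated, at offset ∣ a·d - x ∣.
blockPoint-onto : {a x : ℤ} {d : ℕ} → InBlock a d x → ∃[ u ] blockPoint a d u ≡ x
blockPoint-onto {a} {x} {d} (block ad≤x x<[a+1]d) = fromℕ< offset<d , (begin
  a ℤ.* + d ℤ.+ + toℕ (fromℕ< offset<d)  ≡⟨ cong (λ o → a ℤ.* + d ℤ.+ + o) (FinP.toℕ-fromℕ< offset<d) ⟩
  a ℤ.* + d ℤ.+ + offset                  ≡⟨ cong (λ o → a ℤ.* + d ℤ.+ o) offset≡x-ad ⟩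
  a ℤ.* + d ℤ.+ (x ℤ.- a ℤ.* + d)          ≡⟨ add-diff x (a ℤ.* + d) ⟩
  x                                       ∎)
  where
  open ≡-Reasoning
  add-diff : ∀ i j → j ℤ.+ (i ℤ.- j) ≡ i
  add-diff = solve-∀
  shift : ∀ i e → (i ℤ.+ + 1) ℤ.* e ℤ.- i ℤ.* e ≡ e
  shift = solve-∀
  offset : ℕ
  offset = ∣ a ℤ.* + d ℤ.- x ∣
  offset≡x-ad : + offset ≡ x ℤ.- a ℤ.* + d
  offset≡x-ad = ℤP.∣-∣-≤ ad≤x
  offset<d : offset < d
  offset<d = ℤP.drop‿+<+ (subst₂ ℤ._<_ (sym offset≡x-ad) (shift a (+ d))
    (ℤP.+-monoˡ-< (ℤ.- (a ℤ.* + d)) x<[a+1]d))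

-- Nearness to a cell is decidable: search the finitely many squares of the
-- cell, enumerated block by block.
within? : (N t k : ℕ) (c : Cell) (q : Square) → Dec (Within N t k c q)
within? N t k (a , b) q =
  map′ found complete
    (FinP.any? λ u → FinP.any? λ v → dist q (point u v) ℕ.≤? t)
  where
  d = side N k
  point : Fin d → Fin d → Square
  point u v = blockPoint a d u , blockPoint b d v
  found : ∃[ u ] ∃[ v ] dist q (point u v) ≤ t → Within N t k (a , b) q
  found (u , v , near) =
    point u v , blocks⇒cell {N} {k} (blockPoint-inBlock a d u) (blockPoint-inBlock b d v) , near
  complete : Within N t k (a , b) q → ∃[ u ] ∃[ v ] dist q (point u v) ≤ t
  complete ((x , y) , s∈c , near) with cell⇒blocks {N} {k} {a} {b} s∈c
  ... | x∈a , y∈b with blockPoint-onto x∈a | blockPoint-onto y∈b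
  ... | u , refl | v , refl = u , v , near

within-larger : {N t j : ℕ} (P X : Cell) → ContainedIn N j P X →
  (q : Square) → Within N t j P q → Within N t (suc j) X q
within-larger P X P⊆X q (s , s∈P , near) = s , P⊆X s s∈P , near

-- The cops near P and those near Q are disjoint lists inside the cops
-- near X; as fewer than 2·2^j cops are near X, one list is shorter than
-- 2^j, and that list contains every cop near its cell.
proposition1 : (N C : ℕ) → 1 ≤ N → 1 ≤ C →
  (j : ℕ) → (X : Cell) → (t : ℕ) → 2 * t < N * L j →
  {n : ℕ} → (cops : Cops n) →
  SafeFor N cops t (suc j) X →
  (P Q : Cell) → ContainedIn N j P X → ContainedIn N j Q X → Separated P Q →
  SafeFor N cops t j P ⊎ SafeFor N cops t j Q
proposition1 N _ _ _ j X t 2t<side {n} cops safeX P Q P⊆X Q⊆X P#Q =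
  Sum.map (fewerThan-from-list (nearCops P) (∈-satisfying⁺ (near? P)))
          (fewerThan-from-list (nearCops Q) (∈-satisfying⁺ (near? Q)))
    (one-of-disjoint-lists-short safeX
      (satisfying-unique (near? P)) (satisfying-unique (near? Q))
      disjoint (near-X P P⊆X) (near-X Q Q⊆X))
  where
  near? : (c : Cell) → Decidable (Near N cops t j c)
  near? c i = within? N t j c (cops i)
  nearCops : Cell → List (Fin n)
  nearCops c = satisfying (near? c)
  near-if-listed : (c : Cell) {i : Fin n} → i ∈ nearCops c → Near N cops t j c i
  near-if-listed c = ∈-satisfying⁻ (near? c)
  disjoint : Disjoint (nearCops P) (nearCops Q)
  disjoint (i∈P , i∈Q) =
    not-within-both {N} {t} {j} P Q 2t<side P#Q (cops _) (near-if-listed P i∈P) (near-if-listed Q i∈Q)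
  near-X : (c : Cell) → ContainedIn N j c X → {i : Fin n} → i ∈ nearCops c → Near N cops t (suc j) X i
  near-X c c⊆X i∈c = within-larger {N} {t} {j} c X c⊆X (cops _) (near-if-listed c i∈c)
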